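{- Let $l>1$ be an integer. Then $\|l^m+l^{m'}\|_l=m+1$ for all integers $m\geq m'\geq 1$.
   Context: For a positive integer $l$ and $n\in l\mathbb{Z}^+$, the $l$-complexity $\|n\|_l$ is the minimal number of copies of $l$ needed to express $n$ from $l$ using only addition and multiplication (and parentheses). Equivalently, $\|l\|_l=1$ and $\|n\|_l=\min(\|a\|_l+\|b\|_l)$, the minimum over $a,b\in l\mathbb{Z}^+$ with $a+b=n$ or $ab=n$. -}

module Defs where

open import Data.Nat using (ℕ; _+_; _*_; _≤_)
open import Data.Product using (Σ; _×_)
open import Relation.Binary.PropositionalEquality using (_≡_)

-- Arithmetic expressions built from copies of a single constant l
-- using only addition and multiplication (parenthesisation = tree shape).
data Expr : Set where
  lit : Expr
  _⊕_ : Expr → Expr → Expr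
  _⊗_ : Expr → Expr → Expr

eval : ℕ → Expr → ℕ
eval l lit = l
eval l (e ⊕ f) = eval l e + eval l f
eval l (e ⊗ f) = eval l e * eval l f

copies : Expr → ℕ
copies lit = 1
copies (e ⊕ f) = copies e + copies f
copies (e ⊗ f) = copies e + copies f

-- IsComplexity l n k  :  ‖n‖_l = k, i.e. k is the minimal number of copies
-- of l needed to express n: some expression of value n uses k copies, and
-- every expression of value n uses at least k copies.
IsComplexity : ℕ → ℕ → ℕ → Set
IsComplexity l n k =
  Σ Expr (λ e → (eval l e ≡ n) × (copies e ≡ k))
  × ((e : Expr) → eval l e ≡ n → k ≤ copies e)

-- An expression with k copies of l ≥ 2 has value at most l ^ k, because x + y ≤ x * y
-- once x, y ≥ 2; hence l ^ m + l ^ m′ > l ^ m needs more than m copies. Conversely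
-- l ^ m + l ^ m′ = l ^ (m′ - 1) * (l ^ (m - m′ + 1) + l) is written with exactly m + 1 copies.
module Submission where

open import Defs
open import Data.List using ([]; _∷_)
open import Data.Nat using (ℕ; suc; zero; _+_; _*_; _^_; _≤_; _<_; _>_; z≤n; s≤s)
open import Data.Nat.Properties
open import Data.Nat.Tactic.RingSolver using (solve)
open import Data.Product using (_,_)
open import Relation.Binary.PropositionalEquality using (_≡_; refl; sym; cong; cong₂; subst; module ≡-Reasoning)

scale : ℕ → Expr → Expr
scale zero    e = e
scale (suc k) e = lit ⊗ scale k e

eval-scale : ∀ l k e → eval l (scale k e) ≡ l ^ k * eval l e
eval-scale l zero    e = sym (*-identityˡ (eval l e))
eval-scale l (suc k) e = begin
  l * eval l (scale k e)   ≡⟨ cong (l *_) (eval-scale l k e) ⟩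
  l * (l ^ k * eval l e)   ≡⟨ sym (*-assoc l (l ^ k) (eval l e)) ⟩
  l ^ suc k * eval l e     ∎
  where open ≡-Reasoning

copies-scale : ∀ k e → copies (scale k e) ≡ k + copies e
copies-scale zero    e = refl
copies-scale (suc k) e = cong suc (copies-scale k e)

powerSum : ℕ → ℕ → Expr
powerSum a b = scale a (scale b lit ⊕ lit)

eval-powerSum : ∀ l a b → eval l (powerSum a b) ≡ l ^ (suc a + b) + l ^ suc a
eval-powerSum l a b = begin
  eval l (powerSum a b)                   ≡⟨ eval-scale l a _ ⟩
  l ^ a * (eval l (scale b lit) + l)      ≡⟨ cong (λ x → l ^ a * (x + l)) (eval-scale l b lit) ⟩
  l ^ a * (l ^ b * l + l)                 ≡⟨ *-distribˡ-+ (l ^ a) (l ^ b * l) l ⟩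
  l ^ a * (l ^ b * l) + l ^ a * l         ≡⟨ cong₂ _+_ (sym (*-assoc (l ^ a) (l ^ b) l)) (*-comm (l ^ a) l) ⟩
  l ^ a * l ^ b * l + l ^ suc a           ≡⟨ cong (λ x → x * l + l ^ suc a) (sym (^-distribˡ-+-* l a b)) ⟩
  l ^ (a + b) * l + l ^ suc a             ≡⟨ cong (_+ l ^ suc a) (*-comm (l ^ (a + b)) l) ⟩
  l ^ (suc a + b) + l ^ suc a             ∎
  where open ≡-Reasoning

copies-powerSum : ∀ a b → copies (powerSum a b) ≡ suc (suc a + b)
copies-powerSum a b = begin
  copies (powerSum a b)                   ≡⟨ copies-scale a _ ⟩
  a + (copies (scale b lit) + 1)          ≡⟨ cong (λ c → a + (c + 1)) (copies-scale b lit) ⟩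
  a + (b + 1 + 1)                         ≡⟨ solve (a ∷ b ∷ []) ⟩
  suc (suc a + b)                         ∎
  where open ≡-Reasoning

copies>0 : ∀ e → copies e > 0
copies>0 lit     = s≤s z≤n
copies>0 (e ⊕ f) = ≤-trans (copies>0 e) (m≤m+n (copies e) (copies f))
copies>0 (e ⊗ f) = ≤-trans (copies>0 e) (m≤m+n (copies e) (copies f))

m≤m^n : ∀ m {n} → n > 0 → m ≤ m ^ n
m≤m^n zero          _   = z≤n
m≤m^n m@(suc _) {n} n>0 = subst (_≤ m ^ n) (*-identityʳ m) (^-monoʳ-≤ m {1} {n} n>0)

m+n≤m*n : ∀ {m n} → 2 ≤ m → 2 ≤ n → m + n ≤ m * n
m+n≤m*n {m} {suc n} 2≤m (s≤s 1≤n) = begin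
  m + suc n      ≤⟨ +-monoʳ-≤ m (+-monoˡ-≤ n 1≤n) ⟩
  m + (n + n)    ≡⟨ cong (λ x → m + (n + x)) (sym (+-identityʳ n)) ⟩
  m + 2 * n      ≤⟨ +-monoʳ-≤ m (*-monoˡ-≤ n 2≤m) ⟩
  m + m * n      ≡⟨ sym (*-suc m n) ⟩
  m * suc n      ∎
  where open ≤-Reasoning

eval≤l^copies : ∀ {l} → 1 < l → ∀ e → eval l e ≤ l ^ copies e
eval≤l^copies {l} 1<l lit = m≤m^n l {1} (s≤s z≤n)
eval≤l^copies {l} 1<l (e ⊕ f) = begin
  eval l e + eval l f            ≤⟨ +-mono-≤ (eval≤l^copies 1<l e) (eval≤l^copies 1<l f) ⟩
  l ^ copies e + l ^ copies f    ≤⟨ m+n≤m*n (2≤l^copies e) (2≤l^copies f) ⟩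
  l ^ copies e * l ^ copies f    ≡⟨ sym (^-distribˡ-+-* l (copies e) (copies f)) ⟩
  l ^ (copies e + copies f)      ∎
  where
  open ≤-Reasoning
  2≤l^copies : ∀ e → 2 ≤ l ^ copies e
  2≤l^copies e = ≤-trans 1<l (m≤m^n l (copies>0 e))
eval≤l^copies {l} 1<l (e ⊗ f) = begin
  eval l e * eval l f            ≤⟨ *-mono-≤ (eval≤l^copies 1<l e) (eval≤l^copies 1<l f) ⟩
  l ^ copies e * l ^ copies f    ≡⟨ sym (^-distribˡ-+-* l (copies e) (copies f)) ⟩
  l ^ (copies e + copies f)      ∎
  where open ≤-Reasoning

l^k<eval⇒k<copies : ∀ {l k} → 1 < l → ∀ e → l ^ k < eval l e → k < copies e
l^k<eval⇒k<copies {l@(suc _)} 1<l e l^k<eval = ≰⇒> λ copies≤k →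
  <⇒≱ l^k<eval (≤-trans (eval≤l^copies 1<l e) (^-monoʳ-≤ l copies≤k))

corollary2p4 : (l m m′ : ℕ) → 1 < l → 1 ≤ m′ → m′ ≤ m →
    IsComplexity l (l ^ m + l ^ m′) (suc m)
corollary2p4 l@(suc _) m (suc a) 1<l _ m′≤m with m≤n⇒∃[o]m+o≡n m′≤m
... | b , refl =
  (powerSum a b , eval-powerSum l a b , copies-powerSum a b) ,
  λ e eval≡ → l^k<eval⇒k<copies 1<l e (subst (l ^ m <_) (sym eval≡) l^m<l^m+l^m′)
  where
  l^m<l^m+l^m′ : l ^ m < l ^ m + l ^ suc a
  l^m<l^m+l^m′ = m<m+n (l ^ m) (m^n>0 l (suc a))
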